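{- Let $a\ge 2$ be even, and let $c\ge 0$ and $d$ be integers with $c+d\ge 1$. Then $U=\{(a,-a),(c,d)\}\subseteq\mathcal{B}$ is unavoidable in $\mathcal{B}$.
   Context: The bicyclic inverse semigroup is $\mathcal{B}=\{(a,b)\in\mathbb{Z}\times\mathbb{Z}\mid a\ge 0,\ a+b\ge 0\}$ with multiplication $(a,b)(c,d)=(\max\{c+d,a\}-d,\ b+d)$. A subset $U\subseteq\mathcal{B}$ is avoidable if $\mathcal{B}$ can be partitioned into two sets $A$ and $B$ such that no element of $U$ is a product $st$ of two distinct elements $s\ne t$ both in $A$ or both in $B$; otherwise $U$ is unavoidable. -}

module Defs where

open import Data.Integer using (ℤ; +_; _+_; _-_; _≤_; _⊔_)
open import Data.Bool using (Bool)
open import Data.Product using (Σ; _×_; _,_)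
open import Data.Sum using (_⊎_)
open import Relation.Binary.PropositionalEquality using (_≡_)
open import Relation.Nullary using (¬_)

-- The bicyclic inverse semigroup B = {(a,b) ∈ ℤ×ℤ | a ≥ 0, a + b ≥ 0}.
record 𝓑 : Set where
  constructor ⟨_,_∣_,_⟩
  field
    fst   : ℤ
    snd   : ℤ
    fst≥0 : + 0 ≤ fst
    sum≥0 : + 0 ≤ fst + snd
open 𝓑 public

_≈ᴮ_ : 𝓑 → 𝓑 → Set
s ≈ᴮ t = (fst s ≡ fst t) × (snd s ≡ snd t)

mulFst : ℤ → ℤ → ℤ → ℤ → ℤ
mulFst a b c d = ((c + d) ⊔ a) - d

mulSnd : ℤ → ℤ → ℤ → ℤ → ℤ
mulSnd a b c d = b + d

ProdIs : 𝓑 → 𝓑 → ℤ × ℤ → Set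
ProdIs s t (x , y) =
  (mulFst (fst s) (snd s) (fst t) (snd t) ≡ x) × (mulSnd (fst s) (snd s) (fst t) (snd t) ≡ y)

-- U is avoidable if there is a partition of B into two classes
-- (given by a colouring χ : B → Bool; class A = χ⁻¹(true), class B = χ⁻¹(false))
-- such that no element of U is a product s t of distinct s ≠ t in the same class.
Avoidable : (ℤ × ℤ → Set) → Set
Avoidable U =
  Σ (𝓑 → Bool) λ χ →
    ∀ (s t : 𝓑) → ¬ (s ≈ᴮ t) → χ s ≡ χ t →
      ∀ (u : ℤ × ℤ) → U u → ¬ ProdIs s t u

Unavoidable : (ℤ × ℤ → Set) → Set
Unavoidable U = ¬ Avoidable U

Pair2 : ℤ × ℤ → ℤ × ℤ → ℤ × ℤ → Set
Pair2 p q u = (u ≡ p) ⊎ (u ≡ q)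

module Submission where

-- Write a = 2H with H ≥ 1 and consider
-- the three elements
--     p = (H , -H),   q = (1 + H , -H),   r = (c , d + H)
-- of the bicyclic semigroup.  Using the "weight" fst + snd of an element,
-- the product (x,y)(z,w) is easy to read off in the two extreme regimes:
-- if the weight z + w is at most x it is (x - w , y + w), and if x is at
-- most z + w it is (z , y + w).  This gives
--     p q = (2H , -2H) = (a , -a),   p r = (c , d),   q r = (c , d),
-- and the weights 0, 1 and c + d + H ≥ 2 show that p, q, r are pairwise
-- distinct.  Any 2-colouring of 𝓑 puts two of the three elements in the
-- same class (pigeonhole), and their product lies in U, so U is unavoidable.

open import Defs
open import Data.Nat using (ℕ)
open import Data.Nat.Divisibility using (_∣_)
open import Data.Integer using (ℤ; +_; -_; _+_; _≤_)
open import Data.Product using (_,_)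

import Data.Nat as ℕ
import Data.Nat.Properties as ℕ
open import Data.Nat.Divisibility using (divides)
open import Data.Integer using (_-_; _⊔_; _<_; +≤+; +<+)
open import Data.Integer.Properties
  using (≤-trans; ≤-reflexive; <⇒≤; <⇒≢; <-trans; suc[i]≤j⇒i<j;
         +-monoʳ-≤; +-monoˡ-≤; +-inverseʳ; i≤j+i; i≥j⇒i⊔j≡i; i≤j⇒i⊔j≡j; pos-+)
open import Data.Integer.Tactic.RingSolver using (solve-∀)
open import Data.Bool using (Bool; true; false)
open import Data.Sum using (_⊎_; inj₁; inj₂)
open import Data.Product using (Σ; _×_)
open import Data.Empty using (⊥; ⊥-elim)
open import Relation.Nullary using (¬_)
open import Relation.Binary.PropositionalEquality
  using (_≡_; refl; sym; trans; cong; cong₂; subst; subst₂; module ≡-Reasoning)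

ProductIn : (ℤ × ℤ → Set) → 𝓑 → 𝓑 → Set
ProductIn U s t = Σ (ℤ × ℤ) λ u → U u × ProdIs s t u

twoOfThreeAgree : (x y z : Bool) → (x ≡ y) ⊎ (x ≡ z) ⊎ (y ≡ z)
twoOfThreeAgree true  true  _     = inj₁ refl
twoOfThreeAgree false false _     = inj₁ refl
twoOfThreeAgree true  false true  = inj₂ (inj₁ refl)
twoOfThreeAgree false true  false = inj₂ (inj₁ refl)
twoOfThreeAgree true  false false = inj₂ (inj₂ refl)
twoOfThreeAgree false true  true  = inj₂ (inj₂ refl)

triangle⇒unavoidable : (U : ℤ × ℤ → Set) (p q r : 𝓑) →
  ¬ (p ≈ᴮ q) → ¬ (p ≈ᴮ r) → ¬ (q ≈ᴮ r) →
  ProductIn U p q → ProductIn U p r → ProductIn U q r → Unavoidable U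
triangle⇒unavoidable U p q r p≉q p≉r q≉r pq pr qr (χ , avoids) =
  pigeonhole (twoOfThreeAgree (χ p) (χ q) (χ r))
  where
  monochromatic : ∀ {s t} → ¬ (s ≈ᴮ t) → χ s ≡ χ t → ProductIn U s t → ⊥
  monochromatic {s} {t} s≉t same (u , u∈U , st≡u) = avoids s t s≉t same u u∈U st≡u

  pigeonhole : (χ p ≡ χ q) ⊎ (χ p ≡ χ r) ⊎ (χ q ≡ χ r) → ⊥
  pigeonhole (inj₁ same)        = monochromatic p≉q same pq
  pigeonhole (inj₂ (inj₁ same)) = monochromatic p≉r same pr
  pigeonhole (inj₂ (inj₂ same)) = monochromatic q≉r same qr

weight : 𝓑 → ℤ
weight s = fst s + snd s

weight<⇒≉ : ∀ {s t} → weight s < weight t → ¬ (s ≈ᴮ t)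
weight<⇒≉ ws<wt (fst≡ , snd≡) = <⇒≢ ws<wt (cong₂ _+_ fst≡ snd≡)

mulFst-left : ∀ x y z w → z + w ≤ x → mulFst x y z w ≡ x - w
mulFst-left x y z w zw≤x = cong (_- w) (i≤j⇒i⊔j≡j zw≤x)

mulFst-right : ∀ x y z w → x ≤ z + w → mulFst x y z w ≡ z
mulFst-right x y z w x≤zw = begin
  (z + w) ⊔ x - w  ≡⟨ cong (_- w) (i≥j⇒i⊔j≡i x≤zw) ⟩
  z + w - w        ≡⟨ cancel z w ⟩
  z                ∎
  where
  open ≡-Reasoning
  cancel : ∀ z w → z + w - w ≡ z
  cancel = solve-∀

module Triangle (H : ℤ) (H≥1 : + 1 ≤ H) (c d : ℤ) (c≥0 : + 0 ≤ c) (cd≥1 : + 1 ≤ c + d) where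

  U : ℤ × ℤ → Set
  U = Pair2 (H + H , - (H + H)) (c , d)

  H≥0 : + 0 ≤ H
  H≥0 = <⇒≤ (suc[i]≤j⇒i<j H≥1)

  weightP≡0 : H + - H ≡ + 0
  weightP≡0 = +-inverseʳ H

  weightQ≡1 : + 1 + H + - H ≡ + 1
  weightQ≡1 = cancelH H
    where
    cancelH : ∀ H → + 1 + H + - H ≡ + 1
    cancelH = solve-∀

  1+H≤weightR : + 1 + H ≤ c + (d + H)
  1+H≤weightR = subst (+ 1 + H ≤_) (sym (reassoc c d H)) (+-monoˡ-≤ H cd≥1)
    where
    reassoc : ∀ c d H → c + (d + H) ≡ (c + d) + H
    reassoc = solve-∀

  1+H≥0 : + 0 ≤ + 1 + H
  1+H≥0 = ≤-trans H≥0 (i≤j+i H (+ 1))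

  p q r : 𝓑
  p = ⟨ H       , - H   ∣ H≥0   , ≤-reflexive (sym weightP≡0) ⟩
  q = ⟨ + 1 + H , - H   ∣ 1+H≥0 , ≤-trans (+≤+ ℕ.z≤n) (≤-reflexive (sym weightQ≡1)) ⟩
  r = ⟨ c       , d + H ∣ c≥0   , ≤-trans 1+H≥0 1+H≤weightR ⟩

  1<weightR : + 1 < c + (d + H)
  1<weightR = suc[i]≤j⇒i<j (≤-trans (+-monoʳ-≤ (+ 1) H≥1) 1+H≤weightR)

  p≉q : ¬ (p ≈ᴮ q)
  p≉q = weight<⇒≉ {p} {q} (subst₂ _<_ (sym weightP≡0) (sym weightQ≡1) (+<+ (ℕ.s≤s ℕ.z≤n)))

  p≉r : ¬ (p ≈ᴮ r)
  p≉r = weight<⇒≉ {p} {r} (subst (_< c + (d + H)) (sym weightP≡0) (<-trans (+<+ (ℕ.s≤s ℕ.z≤n)) 1<weightR))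

  q≉r : ¬ (q ≈ᴮ r)
  q≉r = weight<⇒≉ {q} {r} (subst (_< c + (d + H)) (sym weightQ≡1) 1<weightR)

  -- The three products.  In p q the right factor has weight 1 ≤ H; in p r
  -- and q r the left factor's first coordinate is at most the weight of r.
  pq∈U : ProductIn U p q
  pq∈U = (H + H , - (H + H)) , inj₁ refl
       , trans (mulFst-left H (- H) (+ 1 + H) (- H) (subst (_≤ H) (sym weightQ≡1) H≥1)) (doubleFst H)
       , doubleSnd H
    where
    doubleFst : ∀ H → H - - H ≡ H + H
    doubleFst = solve-∀
    doubleSnd : ∀ H → - H + - H ≡ - (H + H)
    doubleSnd = solve-∀

  sndR : - H + (d + H) ≡ d
  sndR = cancelH d H
    where
    cancelH : ∀ d H → - H + (d + H) ≡ d
    cancelH = solve-∀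

  pr∈U : ProductIn U p r
  pr∈U = (c , d) , inj₂ refl
       , mulFst-right H (- H) c (d + H) (≤-trans (i≤j+i H (+ 1)) 1+H≤weightR) , sndR

  qr∈U : ProductIn U q r
  qr∈U = (c , d) , inj₂ refl , mulFst-right (+ 1 + H) (- H) c (d + H) 1+H≤weightR , sndR

  unavoidable : Unavoidable U
  unavoidable = triangle⇒unavoidable U p q r p≉q p≉r q≉r pq∈U pr∈U qr∈U

halveEven : (a : ℕ) → 2 ℕ.≤ a → 2 ∣ a → Σ ℤ λ H → (+ 1 ≤ H) × (+ a ≡ H + H)
halveEven a a≥2 (divides ℕ.zero a≡0) = ⊥-elim (ℕ.<⇒≱ (subst (2 ℕ.≤_) a≡0 a≥2) ℕ.z≤n)
halveEven a a≥2 (divides (ℕ.suc k) a≡2k) =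
  + ℕ.suc k , +≤+ (ℕ.s≤s ℕ.z≤n) , trans (cong +_ (trans a≡2k (double (ℕ.suc k)))) (pos-+ (ℕ.suc k) (ℕ.suc k))
  where
  double : ∀ n → n ℕ.* 2 ≡ n ℕ.+ n
  double n = trans (ℕ.*-comm n 2) (cong (n ℕ.+_) (ℕ.+-identityʳ n))

mainTheorem3 : (a : ℕ) → 2 Data.Nat.≤ a → 2 ∣ a →
    (c d : ℤ) → + 0 ≤ c → + 1 ≤ c + d →
    Unavoidable (Pair2 (+ a , - (+ a)) (c , d))
mainTheorem3 a a≥2 2∣a c d c≥0 cd≥1 with halveEven a a≥2 2∣a
... | H , H≥1 , a≡H+H =
  subst (λ x → Unavoidable (Pair2 (x , - x) (c , d))) (sym a≡H+H)
    (Triangle.unavoidable H H≥1 c d c≥0 cd≥1)
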